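{- Consider a one-red TAP instance with $n$ blue features, and let $\mathrm{OPT}_{\mathrm{SC}}$ be the minimum number of red features appearing in a set of exemplars in which all $n$ blue features appear. Let $K=\lceil \tfrac12(n-\mathrm{OPT}_{\mathrm{SC}})\rceil$. Then GREEDY covers at least $2K$ blue features in its first $K$ iterations.
   Context: Target Approximation Problem (TAP): the input is a finite groundset $U$ of features, a target $T\subseteq U$, and a set $S$ of exemplars, each a subset of $U$. Features in $U\cap T$ are blue and features in $U\setminus T$ are red. For $S'\subseteq S$, a feature appears in $S'$ if it lies in at least one exemplar of $S'$. Standing assumption: every feature appears in at least one exemplar. A TAP instance is one-red if every exemplar contains exactly one red feature. In a one-red instance, a red feature $r$ covers a blue feature $b$ if some exemplar contains both $r$ and $b$. GREEDY: until every blue feature is covered, in each iteration choose a red feature that covers the largest number of not-yet-covered blue features (ties broken arbitrarily); those blue features become covered. -}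

module Defs where

open import Data.Nat using (ℕ; _≤_)
open import Data.Bool using (_∧_; not)
open import Data.Fin using (Fin)
open import Data.Fin.Subset using (Subset; _∈_; _∉_; _∪_; _─_; ⊥; ∣_∣)
open import Data.Fin.Subset.Properties using (_∈?_)
open import Data.Fin.Properties using (any?)
open import Data.Vec using (tabulate)
open import Data.List using (List; []; _∷_; foldr)
open import Data.Product using (_×_; ∃; ∃-syntax; _,_)
open import Relation.Nullary using (¬_)
open import Relation.Binary.PropositionalEquality using (_≡_)
open import Relation.Nullary.Decidable using (⌊_⌋; _×-dec_)

-- A TAP instance: groundset U = Fin N, target T : Subset N,
-- exemplars ex : Fin e → Subset N (the e exemplars, each a subset of U).
-- Blue features: members of T.  Red features: non-members of T.

module TAP {N e : ℕ} (T : Subset N) (ex : Fin e → Subset N) where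

  Appears : Subset e → Fin N → Set
  Appears S' f = ∃[ i ] (i ∈ S' × f ∈ ex i)

  StandingAssumption : Set
  StandingAssumption = ∀ f → ∃[ i ] (f ∈ ex i)

  OneRed : Set
  OneRed = ∀ i → ∃[ r ] (r ∈ ex i × r ∉ T × (∀ r' → r' ∈ ex i → r' ∉ T → r' ≡ r))

  nBlue : ℕ
  nBlue = ∣ T ∣

  redsIn : Subset e → Subset N
  redsIn S' = tabulate (λ f → not ⌊ f ∈? T ⌋ ∧ ⌊ any? (λ i → i ∈? S' ×-dec f ∈? ex i) ⌋)

  AllBlueAppear : Subset e → Set
  AllBlueAppear S' = ∀ b → b ∈ T → Appears S' b

  IsOptSC : ℕ → Set
  IsOptSC opt = (∃[ S' ] (AllBlueAppear S' × ∣ redsIn S' ∣ ≡ opt))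
              × (∀ S' → AllBlueAppear S' → opt ≤ ∣ redsIn S' ∣)

  Covers : Fin N → Fin N → Set
  Covers r b = ∃[ i ] (r ∈ ex i × b ∈ ex i)

  covSet : Fin N → Subset N
  covSet r = tabulate (λ b → ⌊ b ∈? T ⌋ ∧ ⌊ any? (λ i → r ∈? ex i ×-dec b ∈? ex i) ⌋)

  coveredBy : List (Fin N) → Subset N
  coveredBy rs = foldr (λ r C → covSet r ∪ C) ⊥ rs

  AllCovered : Subset N → Set
  AllCovered C = ∀ b → b ∈ T → b ∈ C

  -- GreedyFrom C rs: starting with covered set C, GREEDY (with some
  -- tie-breaking) chooses the red features rs in this order and then stops.
  data GreedyFrom (C : Subset N) : List (Fin N) → Set where
    done : AllCovered C → GreedyFrom C []
    step : ∀ {r rs} → ¬ AllCovered C → r ∉ T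
         → (∀ r' → r' ∉ T → ∣ covSet r' ─ C ∣ ≤ ∣ covSet r ─ C ∣)
         → GreedyFrom (C ∪ covSet r) rs
         → GreedyFrom C (r ∷ rs)

  GreedyRun : List (Fin N) → Set
  GreedyRun rs = GreedyFrom ⊥ rs

-- Call a covered set C saturated when no red feature covers more than one
-- blue feature outside C.  The OPT reds of an optimal exemplar set cover all
-- blues, so at a saturated C at most OPT blues are uncovered: |C| ≥ n − OPT ≥ 2K − 1.
-- While GREEDY's current set is unsaturated its choice gains at least two blues;
-- by one-redness and the standing assumption every uncovered blue is covered by
-- some red, so even a step from a saturated set gains one blue.  Either way,
-- after K steps at least 2K blues are covered (and 2K ≤ n, since OPT = 0 forces n = 0).

module Submission where

open import Defs
open import Data.Nat using (ℕ; _≤_; _*_; _∸_; ⌈_/2⌉)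
open import Data.Fin using (Fin)
open import Data.Fin.Subset using (Subset; ∣_∣)
open import Data.List using (List; take)

open import Data.Nat using (zero; suc; _+_; _<_; _⊓_; z≤n; s≤s; _≤?_)
open import Data.Nat.Properties
open import Data.Bool using (true; false; not; _∧_; _∨_)
open import Data.Vec using ([]; _∷_; here; there)
open import Data.Vec.Properties using (lookup⇒[]=; []=⇒lookup; lookup∘tabulate)
open import Data.Fin.Subset using (inside; outside; _∈_; _∉_; _∪_; _─_; ⊥; _⊆_)
open import Data.Fin.Subset.Properties
  using (_∈?_; p⊆q⇒∣p∣≤∣q∣; ∣⊥∣≡0; ∣p─q∣≤∣p∣; ∣p∣≤∣p∪q∣; x∈p∪q⁺; q⊆p∪q;
         x∈p∧x∉q⇒x∈p─q; x∈p⇒∣p-x∣<∣p∣; ∪-assoc; ∪-identityˡ)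
open import Data.Fin.Properties using (any?; ¬∀⟶∃¬)
open import Data.List using ([]; _∷_; map; length)
open import Data.List.Properties using (length-map)
open import Data.List.Relation.Unary.Any as Any using ()
open import Data.List.Relation.Unary.All as All using (All; []; _∷_)
open import Data.List.Membership.Propositional using () renaming (_∈_ to _∈ˡ_)
open import Data.List.Membership.Propositional.Properties using (∈-map⁺; ∈-map⁻)
open import Data.Product using (∃-syntax; _,_; _×_)
open import Data.Sum using (inj₁; inj₂)
open import Function using (_∘_)
open import Relation.Nullary using (Dec; ¬_; yes; no; contradiction)
open import Relation.Nullary.Decidable
  using (isYes; isYes≗does; dec-true; dec-false; decidable-stable; _×-dec_; _→-dec_)
open import Relation.Binary.PropositionalEquality using (_≡_; refl; sym; trans; cong; cong₂)

isYes-true : ∀ {a} {A : Set a} (a? : Dec A) → A → isYes a? ≡ true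
isYes-true a? a = trans (isYes≗does a?) (dec-true a? a)

isYes-false : ∀ {a} {A : Set a} (a? : Dec A) → ¬ A → isYes a? ≡ false
isYes-false a? ¬a = trans (isYes≗does a?) (dec-false a? ¬a)

2*⌈n/2⌉≤1+n : ∀ n → 2 * ⌈ n /2⌉ ≤ suc n
2*⌈n/2⌉≤1+n zero = z≤n
2*⌈n/2⌉≤1+n (suc zero) = s≤s (s≤s z≤n)
2*⌈n/2⌉≤1+n (suc (suc n)) rewrite *-suc 2 ⌈ n /2⌉ = s≤s (s≤s (2*⌈n/2⌉≤1+n n))

2*⌈n∸m/2⌉≤n : ∀ n m → (m ≡ 0 → n ≡ 0) → 2 * ⌈ (n ∸ m) /2⌉ ≤ n
2*⌈n∸m/2⌉≤n zero m _ = ≤-reflexive (cong (λ k → 2 * ⌈ k /2⌉) (0∸n≡0 m))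
2*⌈n∸m/2⌉≤n (suc n) zero n≡0 with () ← n≡0 refl
2*⌈n∸m/2⌉≤n (suc n) (suc m) _ = ≤-trans (2*⌈n/2⌉≤1+n (n ∸ m)) (s≤s (m∸n≤m n m))

∣p∪q∣≡∣p∣+∣q─p∣ : ∀ {n} (p q : Subset n) → ∣ p ∪ q ∣ ≡ ∣ p ∣ + ∣ q ─ p ∣
∣p∪q∣≡∣p∣+∣q─p∣ [] [] = refl
∣p∪q∣≡∣p∣+∣q─p∣ (inside ∷ p) (_ ∷ q) = cong suc (∣p∪q∣≡∣p∣+∣q─p∣ p q)
∣p∪q∣≡∣p∣+∣q─p∣ (outside ∷ p) (inside ∷ q) =
  trans (cong suc (∣p∪q∣≡∣p∣+∣q─p∣ p q)) (sym (+-suc ∣ p ∣ ∣ q ─ p ∣))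
∣p∪q∣≡∣p∣+∣q─p∣ (outside ∷ p) (outside ∷ q) = ∣p∪q∣≡∣p∣+∣q─p∣ p q

∣p∪q∣≤∣p∣+∣q∣ : ∀ {n} (p q : Subset n) → ∣ p ∪ q ∣ ≤ ∣ p ∣ + ∣ q ∣
∣p∪q∣≤∣p∣+∣q∣ p q = begin
  ∣ p ∪ q ∣         ≡⟨ ∣p∪q∣≡∣p∣+∣q─p∣ p q ⟩
  ∣ p ∣ + ∣ q ─ p ∣ ≤⟨ +-monoʳ-≤ ∣ p ∣ (∣p─q∣≤∣p∣ q p) ⟩
  ∣ p ∣ + ∣ q ∣     ∎
  where open ≤-Reasoning

─-distribʳ-∪ : ∀ {n} (p q r : Subset n) → (p ∪ q) ─ r ≡ (p ─ r) ∪ (q ─ r)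
─-distribʳ-∪ [] [] [] = refl
─-distribʳ-∪ (x ∷ p) (y ∷ q) (inside ∷ r) = cong (outside ∷_) (─-distribʳ-∪ p q r)
─-distribʳ-∪ (x ∷ p) (y ∷ q) (outside ∷ r) = cong ((x ∨ y) ∷_) (─-distribʳ-∪ p q r)

x∈p⇒0<∣p∣ : ∀ {n} {p : Subset n} {x} → x ∈ p → 0 < ∣ p ∣
x∈p⇒0<∣p∣ x∈p = ≤-<-trans z≤n (x∈p⇒∣p-x∣<∣p∣ x∈p)

elements : ∀ {n} → Subset n → List (Fin n)
elements [] = []
elements (inside ∷ p) = Fin.zero ∷ map Fin.suc (elements p)
elements (outside ∷ p) = map Fin.suc (elements p)

length-elements : ∀ {n} (p : Subset n) → length (elements p) ≡ ∣ p ∣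
length-elements [] = refl
length-elements (inside ∷ p) = cong suc (trans (length-map Fin.suc (elements p)) (length-elements p))
length-elements (outside ∷ p) = trans (length-map Fin.suc (elements p)) (length-elements p)

∈-elements⁺ : ∀ {n} {p : Subset n} {x} → x ∈ p → x ∈ˡ elements p
∈-elements⁺ {p = inside ∷ p} here = Any.here refl
∈-elements⁺ {p = inside ∷ p} (there x∈p) = Any.there (∈-map⁺ Fin.suc (∈-elements⁺ x∈p))
∈-elements⁺ {p = outside ∷ p} (there x∈p) = ∈-map⁺ Fin.suc (∈-elements⁺ x∈p)

∈-elements⁻ : ∀ {n} {p : Subset n} {x} → x ∈ˡ elements p → x ∈ p
∈-elements⁻ {p = inside ∷ p} (Any.here refl) = here
∈-elements⁻ {p = inside ∷ p} (Any.there x∈) with _ , y∈ , refl ← ∈-map⁻ Fin.suc x∈ =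
  there (∈-elements⁻ y∈)
∈-elements⁻ {p = outside ∷ p} x∈ with _ , y∈ , refl ← ∈-map⁻ Fin.suc x∈ =
  there (∈-elements⁻ y∈)

module Greedy {N e : ℕ} (T : Subset N) (ex : Fin e → Subset N) where
  open TAP T ex

  gain : Fin N → Subset N → ℕ
  gain r C = ∣ covSet r ─ C ∣

  Saturated : Subset N → Set
  Saturated C = ∀ r → r ∉ T → gain r C ≤ 1

  ∣C∪covSet∣≡∣C∣+gain : ∀ C r → ∣ C ∪ covSet r ∣ ≡ ∣ C ∣ + gain r C
  ∣C∪covSet∣≡∣C∣+gain C r = ∣p∪q∣≡∣p∣+∣q─p∣ C (covSet r)

  covers⇒∈covSet : ∀ {r b} → Covers r b → b ∈ T → b ∈ covSet r
  covers⇒∈covSet {r} {b} cov b∈T = lookup⇒[]= b _ (trans (lookup∘tabulate _ b)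
    (cong₂ _∧_ (isYes-true (b ∈? T) b∈T)
               (isYes-true (any? λ i → r ∈? ex i ×-dec b ∈? ex i) cov)))

  ∈-redsIn : ∀ {S' r i} → r ∉ T → i ∈ S' → r ∈ ex i → r ∈ redsIn S'
  ∈-redsIn {S'} {r} {i} r∉T i∈S' r∈i = lookup⇒[]= r _ (trans (lookup∘tabulate _ r)
    (cong₂ _∧_ (cong not (isYes-false (r ∈? T) r∉T))
               (isYes-true (any? λ j → j ∈? S' ×-dec r ∈? ex j) (i , i∈S' , r∈i))))

  redsIn-red : ∀ {S' r} → r ∈ redsIn S' → r ∉ T
  redsIn-red {S'} {r} r∈ r∈T = contradiction true≡false λ ()
    where
    true≡false : true ≡ false
    true≡false = trans (sym ([]=⇒lookup r∈)) (trans (lookup∘tabulate _ r)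
      (cong (λ t → not t ∧ _) (isYes-true (r ∈? T) r∈T)))

  ∈-coveredBy : ∀ {r b} l → r ∈ˡ l → b ∈ covSet r → b ∈ coveredBy l
  ∈-coveredBy (_ ∷ _) (Any.here refl) b∈ = x∈p∪q⁺ (inj₁ b∈)
  ∈-coveredBy (_ ∷ l) (Any.there r∈l) b∈ = x∈p∪q⁺ (inj₂ (∈-coveredBy l r∈l b∈))

  optimalRedCover : OneRed → ∀ {opt} → IsOptSC opt →
    ∃[ l ] (All (_∉ T) l × length l ≡ opt × T ⊆ coveredBy l)
  optimalRedCover oneRed ((S' , allBlue , ∣reds∣≡opt) , _) =
    l , All.tabulate (redsIn-red ∘ ∈-elements⁻) , trans (length-elements (redsIn S')) ∣reds∣≡opt , T⊆
    where
    l = elements (redsIn S')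
    T⊆ : T ⊆ coveredBy l
    T⊆ {b} b∈T with i , i∈S' , b∈i ← allBlue b b∈T
                  with r , r∈i , r∉T , _ ← oneRed i =
      ∈-coveredBy l (∈-elements⁺ (∈-redsIn r∉T i∈S' r∈i)) (covers⇒∈covSet (i , r∈i , b∈i) b∈T)

  ∣coveredBy─C∣≤length : ∀ C l → All (λ r → gain r C ≤ 1) l → ∣ coveredBy l ─ C ∣ ≤ length l
  ∣coveredBy─C∣≤length C [] [] = ≤-trans (∣p─q∣≤∣p∣ ⊥ C) (≤-reflexive (∣⊥∣≡0 N))
  ∣coveredBy─C∣≤length C (r ∷ l) (gain≤1 ∷ gains≤1) = begin
    ∣ (covSet r ∪ coveredBy l) ─ C ∣       ≡⟨ cong ∣_∣ (─-distribʳ-∪ (covSet r) (coveredBy l) C) ⟩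
    ∣ (covSet r ─ C) ∪ (coveredBy l ─ C) ∣ ≤⟨ ∣p∪q∣≤∣p∣+∣q∣ (covSet r ─ C) (coveredBy l ─ C) ⟩
    gain r C + ∣ coveredBy l ─ C ∣         ≤⟨ +-mono-≤ gain≤1 (∣coveredBy─C∣≤length C l gains≤1) ⟩
    suc (length l)                         ∎
    where open ≤-Reasoning

  -- Each of the opt reds of an optimal cover adds at most one blue to C.
  saturated⇒∣T∣≤opt+∣C∣ : OneRed → ∀ {opt} → IsOptSC opt → ∀ {C} → Saturated C → ∣ T ∣ ≤ opt + ∣ C ∣
  saturated⇒∣T∣≤opt+∣C∣ oneRed isOpt {C} saturated
    with l , reds , refl , T⊆ ← optimalRedCover oneRed isOpt = begin
      ∣ T ∣                       ≤⟨ p⊆q⇒∣p∣≤∣q∣ (q⊆p∪q C _ ∘ T⊆) ⟩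
      ∣ C ∪ coveredBy l ∣         ≡⟨ ∣p∪q∣≡∣p∣+∣q─p∣ C (coveredBy l) ⟩
      ∣ C ∣ + ∣ coveredBy l ─ C ∣ ≤⟨ +-monoʳ-≤ ∣ C ∣ (∣coveredBy─C∣≤length C l (All.map (saturated _) reds)) ⟩
      ∣ C ∣ + length l            ≡⟨ +-comm ∣ C ∣ (length l) ⟩
      length l + ∣ C ∣            ∎
    where open ≤-Reasoning

  IsOptSC-0⇒∣T∣≡0 : OneRed → IsOptSC 0 → ∣ T ∣ ≡ 0
  IsOptSC-0⇒∣T∣≡0 oneRed isOpt with [] , _ , _ , T⊆ ← optimalRedCover oneRed isOpt =
    n≤0⇒n≡0 (≤-trans (p⊆q⇒∣p∣≤∣q∣ T⊆) (≤-reflexive (∣⊥∣≡0 N)))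

  uncovered⇒0<gain : StandingAssumption → OneRed → ∀ {C} → ¬ AllCovered C → ∃[ r ] (r ∉ T × 0 < gain r C)
  uncovered⇒0<gain standing oneRed {C} uncovered
    with b , ¬[b∈T⇒b∈C] ← ¬∀⟶∃¬ N (λ b → b ∈ T → b ∈ C) (λ b → b ∈? T →-dec b ∈? C) uncovered
    with i , b∈i ← standing b
    with r , r∈i , r∉T , _ ← oneRed i = r , r∉T , x∈p⇒0<∣p∣ (x∈p∧x∉q⇒x∈p─q b∈covSet b∉C)
    where
    b∉C : b ∉ C
    b∉C b∈C = ¬[b∈T⇒b∈C] λ _ → b∈C
    b∈T : b ∈ T
    b∈T = decidable-stable (b ∈? T) λ b∉T → ¬[b∈T⇒b∈C] λ b∈T → contradiction b∈T b∉T
    b∈covSet : b ∈ covSet r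
    b∈covSet = covers⇒∈covSet (i , r∈i , b∈i) b∈T

  module _ (standing : StandingAssumption) (oneRed : OneRed) {t : ℕ} (t≤∣T∣ : t ≤ ∣ T ∣)
           (t≤1+∣C∣ : ∀ {C} → Saturated C → t ≤ suc ∣ C ∣) where

    -- A greedy step from an unsaturated C gains at least two blues; a step from a
    -- saturated C gains at least one, which already brings the count to t.
    greedy-covers : ∀ {C rs} → GreedyFrom C rs → ∀ k →
      t ⊓ (∣ C ∣ + 2 * k) ≤ ∣ C ∪ coveredBy (take k rs) ∣
    greedy-covers {C} _ zero = begin
      t ⊓ (∣ C ∣ + 0) ≤⟨ m⊓n≤n t _ ⟩
      ∣ C ∣ + 0       ≡⟨ +-identityʳ ∣ C ∣ ⟩
      ∣ C ∣           ≤⟨ ∣p∣≤∣p∪q∣ C _ ⟩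
      _               ∎
      where open ≤-Reasoning
    greedy-covers {C} (done allCovered) (suc k) = begin
      t ⊓ _       ≤⟨ m⊓n≤m t _ ⟩
      t           ≤⟨ t≤∣T∣ ⟩
      ∣ T ∣       ≤⟨ p⊆q⇒∣p∣≤∣q∣ (allCovered _) ⟩
      ∣ C ∣       ≤⟨ ∣p∣≤∣p∪q∣ C _ ⟩
      ∣ C ∪ ⊥ ∣   ∎
      where open ≤-Reasoning
    greedy-covers {C} (step {r} {rs} uncovered _ best run) (suc k)
      rewrite sym (∪-assoc C (covSet r) (coveredBy (take k rs)))
      with 2 ≤? gain r C
    ... | yes 2≤gain = ≤-trans (⊓-monoʳ-≤ t grows) (greedy-covers run k)
      where
      open ≤-Reasoning
      grows : ∣ C ∣ + 2 * suc k ≤ ∣ C ∪ covSet r ∣ + 2 * k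
      grows = begin
        ∣ C ∣ + 2 * suc k        ≡⟨ cong (∣ C ∣ +_) (*-suc 2 k) ⟩
        ∣ C ∣ + (2 + 2 * k)      ≡⟨ +-assoc ∣ C ∣ 2 (2 * k) ⟨
        ∣ C ∣ + 2 + 2 * k        ≤⟨ +-monoˡ-≤ (2 * k) (+-monoʳ-≤ ∣ C ∣ 2≤gain) ⟩
        ∣ C ∣ + gain r C + 2 * k ≡⟨ cong (_+ 2 * k) (∣C∪covSet∣≡∣C∣+gain C r) ⟨
        ∣ C ∪ covSet r ∣ + 2 * k ∎
    ... | no 2≰gain = begin
      t ⊓ _                                      ≤⟨ m⊓n≤m t _ ⟩
      t                                          ≤⟨ t≤1+∣C∣ saturated ⟩
      suc ∣ C ∣                                  ≤⟨ m<m+n ∣ C ∣ 0<gain ⟩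
      ∣ C ∣ + gain r C                           ≡⟨ ∣C∪covSet∣≡∣C∣+gain C r ⟨
      ∣ C ∪ covSet r ∣                           ≤⟨ ∣p∣≤∣p∪q∣ (C ∪ covSet r) _ ⟩
      ∣ (C ∪ covSet r) ∪ coveredBy (take k rs) ∣ ∎
      where
      open ≤-Reasoning
      saturated : Saturated C
      saturated r' r'∉T = ≤-trans (best r' r'∉T) (≤-pred (≰⇒> 2≰gain))
      0<gain : 0 < gain r C
      0<gain with r₀ , r₀∉T , 0<gain₀ ← uncovered⇒0<gain standing oneRed uncovered =
        <-≤-trans 0<gain₀ (best r₀ r₀∉T)

lemma6p3 : ∀ {N e} (T : Subset N) (ex : Fin e → Subset N)
    → TAP.StandingAssumption T ex → TAP.OneRed T ex
    → (opt : ℕ) → TAP.IsOptSC T ex opt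
    → (rs : List (Fin N)) → TAP.GreedyRun T ex rs
    → 2 * ⌈ (∣ T ∣ ∸ opt) /2⌉ ≤ ∣ TAP.coveredBy T ex (take ⌈ (∣ T ∣ ∸ opt) /2⌉ rs) ∣
lemma6p3 {N} T ex standing oneRed opt isOpt rs run = begin
  2 * K                          ≤⟨ ⊓-glb ≤-refl (≤-reflexive (cong (_+ 2 * K) (sym (∣⊥∣≡0 N)))) ⟩
  2 * K ⊓ (∣ ⊥ {N} ∣ + 2 * K)    ≤⟨ greedy-covers standing oneRed 2K≤∣T∣ 2K≤1+∣C∣ run K ⟩
  ∣ ⊥ ∪ coveredBy (take K rs) ∣  ≡⟨ cong ∣_∣ (∪-identityˡ (coveredBy (take K rs))) ⟩
  ∣ coveredBy (take K rs) ∣      ∎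
  where
  open ≤-Reasoning
  open TAP T ex
  open Greedy T ex
  K : ℕ
  K = ⌈ (∣ T ∣ ∸ opt) /2⌉
  2K≤∣T∣ : 2 * K ≤ ∣ T ∣
  2K≤∣T∣ = 2*⌈n∸m/2⌉≤n ∣ T ∣ opt λ { refl → IsOptSC-0⇒∣T∣≡0 oneRed isOpt }
  2K≤1+∣C∣ : ∀ {C} → Saturated C → 2 * K ≤ suc ∣ C ∣
  2K≤1+∣C∣ saturated = ≤-trans (2*⌈n/2⌉≤1+n (∣ T ∣ ∸ opt))
    (s≤s (m≤n+o⇒m∸n≤o ∣ T ∣ opt (saturated⇒∣T∣≤opt+∣C∣ oneRed isOpt saturated)))
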